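{- Let $G$ be a finite simple graph without isolated vertices such that $\Gamma_t(G)=2\gamma_{\rm gr}^{\rm Z}(G)$, and let $D$ be a minimal total dominating set of $G$ with $|D|=\Gamma_t(G)$. Let $C_1,\ldots,C_\ell$ be the connected components of $G[D]$ isomorphic to $K_2$, with $V(C_i)=\{x_i,y_i\}$, and let $A_i(D)$, $H$, $\sim$, $X_B(D)$, $m_B(D)$ be as defined in the context. Then: (i) every connected component of $G[D]$ is isomorphic to $K_2$, so $|D|=2\ell$; (ii) $N[x_i]\cap A_i(D)=N[y_i]\cap A_i(D)$ for each $i\in[\ell]$; (iii) $A_i(D)$ induces a complete graph for each $i\in[\ell]$; (iv) there are no edges between $A_i(D)$ and $A_j(D)$ for any distinct $i,j\in[\ell]$; (v) any two vertices of $A_i(D)$ are closed twins (i.e., have equal closed neighborhoods) for each $i\in[\ell]$; (vi) for all adjacent vertices $u,v\in V(H)$, $|\{i\in[\ell]: u\sim A_i(D)\text{ and } v\sim A_i(D)\}|\ge 1$; (vii) for all non-adjacent vertices $u,v\in V(H)$, $|\{i\in[\ell]: u\sim A_i(D)\text{ and } v\sim A_i(D)\}|\ne 1$; (viii) for every $B\subseteq V(H)$, letting $B'$ be the set of isolated vertices of $G[B]$, we have $\gamma_{\rm gr}^{\rm Z}(G[B\setminus B'])+m_{B'}(D)\le |X_B(D)|$.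
   Context: $N(v)$, $N[v]=N(v)\cup\{v\}$ are open/closed neighborhoods; $G[X]$ is the induced subgraph; $[\ell]=\{1,\ldots,\ell\}$. A total dominating set (TD-set) is a set $D$ such that every vertex has a neighbor in $D$; it is minimal if no proper subset is a TD-set; $\Gamma_t(G)$ is the maximum size of a minimal TD-set (defined for graphs without isolated vertices). A sequence $(v_1,\ldots,v_k)$ of distinct vertices is a Z-sequence if for every $i\in\{1,\ldots,k\}$, $N(v_i)\setminus\bigcup_{j<i}N[v_j]\ne\emptyset$; $\gamma_{\rm gr}^{\rm Z}$ of a graph is the maximum length of a Z-sequence in it (equal to $0$ for the graph with no vertices). For $i\in[\ell]$, $A_i(D)$ is the set of vertices of $G$ that have a neighbor in $\{x_i,y_i\}$ and no neighbor in $D\setminus\{x_i,y_i\}$. $H$ is the graph $G-(A_1(D)\cup\cdots\cup A_\ell(D))$. For a vertex $v$ and set $X$, $v\sim X$ means $v$ is adjacent to every vertex of $X$. For $B\subseteq V(H)$, $X_B(D)=\{i\in[\ell]: u\sim A_i(D)\text{ for some }u\in B\}$, and $m_B(D)$ is the largest cardinality of an inclusion-minimal subset $X\subseteq X_B(D)$ such that $B\subseteq\bigcup_{i\in X}N(x_i)$. -}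

module Defs where

open import Data.Nat using (ℕ; _≤_; _+_; _*_)
open import Data.Fin using (Fin)
open import Data.Fin.Subset using (Subset; _∈_; _⊆_; ∣_∣)
open import Data.List using (List; []; _∷_; length)
open import Data.List.Relation.Unary.All using (All)
open import Data.Product using (_×_; ∃; _,_)
open import Data.Sum using (_⊎_)
open import Data.Unit using (⊤)
open import Relation.Nullary using (¬_; Dec)
open import Relation.Binary.PropositionalEquality using (_≡_; _≢_)
open import Function.Bundles using (_⇔_)

record Graph (n : ℕ) : Set₁ where
  field
    E      : Fin n → Fin n → Set
    E?     : ∀ u v → Dec (E u v)
    sym    : ∀ {u v} → E u v → E v u
    irrefl : ∀ {u} → ¬ E u u

-- S represents the predicate P (i.e. S = {i : P i}); used to take cardinalities.
Represents : {m : ℕ} → (Fin m → Set) → Subset m → Set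
Represents P S = ∀ i → (i ∈ S) ⇔ P i

module _ {n : ℕ} (G : Graph n) where
  open Graph G

  NoIsolated : Set
  NoIsolated = ∀ v → ∃ λ u → E v u

  InClosedNbhd : Fin n → Fin n → Set
  InClosedNbhd v w = w ≡ v ⊎ E v w

  IsTD : Subset n → Set
  IsTD D = ∀ v → ∃ λ u → u ∈ D × E v u

  IsMinimalTD : Subset n → Set
  IsMinimalTD D = IsTD D × (∀ S → S ⊆ D → S ≢ D → ¬ IsTD S)

  -- D is a minimal TD-set with |D| = Γ_t(G)
  IsMaxMinimalTD : Subset n → Set
  IsMaxMinimalTD D = IsMinimalTD D × (∀ D' → IsMinimalTD D' → ∣ D' ∣ ≤ ∣ D ∣)

  -- Z-sequences of the induced subgraph G[X] (X given as a predicate on vertices).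
  -- ZSeqFrom X prev vs : vs continues a Z-sequence whose earlier vertices are prev.
  ZSeqFrom : (Fin n → Set) → List (Fin n) → List (Fin n) → Set
  ZSeqFrom X prev [] = ⊤
  ZSeqFrom X prev (v ∷ vs) =
    X v × All (λ u → v ≢ u) prev
    × (∃ λ w → X w × E v w × All (λ u → ¬ InClosedNbhd u w) prev)
    × ZSeqFrom X (v ∷ prev) vs

  IsZSeq : (Fin n → Set) → List (Fin n) → Set
  IsZSeq X vs = ZSeqFrom X [] vs

  IsGammaZ : (Fin n → Set) → ℕ → Set
  IsGammaZ X k = (∃ λ vs → IsZSeq X vs × length vs ≡ k)
               × (∀ vs → IsZSeq X vs → length vs ≤ k)

  IsK2Comp : Subset n → Fin n → Fin n → Set
  IsK2Comp D x y = x ∈ D × y ∈ D × E x y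
                 × (∀ z → z ∈ D → E x z → z ≡ y)
                 × (∀ z → z ∈ D → E y z → z ≡ x)

  IsK2Enumeration : Subset n → (ℓ : ℕ) → (Fin ℓ → Fin n) → (Fin ℓ → Fin n) → Set
  IsK2Enumeration D ℓ x y =
    (∀ i → IsK2Comp D (x i) (y i))
    × (∀ i j → (x i ≡ x j ⊎ x i ≡ y j) → i ≡ j)
    × (∀ a b → IsK2Comp D a b → ∃ λ i → (a ≡ x i × b ≡ y i) ⊎ (a ≡ y i × b ≡ x i))

  module _ (D : Subset n) {ℓ : ℕ} (x y : Fin ℓ → Fin n) where

    InA : Fin ℓ → Fin n → Set
    InA i v = (E v (x i) ⊎ E v (y i))
            × (∀ d → d ∈ D → d ≢ x i → d ≢ y i → ¬ E v d)

    InH : Fin n → Set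
    InH v = ∀ i → ¬ InA i v

    AdjAll : Fin n → Fin ℓ → Set
    AdjAll u i = ∀ w → InA i w → E u w

    InXB : (Fin n → Set) → Fin ℓ → Set
    InXB B i = ∃ λ u → B u × AdjAll u i

    Covers : (Fin n → Set) → Subset ℓ → Set
    Covers B X = ∀ u → B u → ∃ λ i → i ∈ X × E u (x i)

    IsMinCover : (Fin n → Set) → Subset ℓ → Set
    IsMinCover B X = (∀ i → i ∈ X → InXB B i) × Covers B X
                   × (∀ Y → Y ⊆ X → Y ≢ X → ¬ Covers B Y)

    IsMB : (Fin n → Set) → ℕ → Set
    IsMB B m = (∃ λ X → IsMinCover B X × ∣ X ∣ ≡ m)
             × (∀ X → IsMinCover B X → ∣ X ∣ ≤ m)

  IsolatedIn : Subset n → Fin n → Set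
  IsolatedIn B v = v ∈ B × (∀ w → w ∈ B → ¬ E v w)

-- A Z-sequence can be read off from any list of pairs (v , w) with w ∈ N(v) in which, for
-- every earlier pair (u , _), the later vertex v differs from u and w ∉ N[u]; γ_gr^Z(G)
-- bounds the length of every such list.  With D of size Γ_t(G) = 2 γ_gr^Z(G), pairing each
-- vertex of D with a private neighbour, and dropping one vertex of each K2-component whose
-- two vertices are each other's only private neighbours, gives such a list; counting shows
-- that γ_gr^Z(G) = ℓ and that every K2-component is of that kind, whence (i).  From then on
-- the pairs (x_i , y_i), i ∈ [ℓ], form a longest such list, so every structural claim is
-- proved by inserting a few extra pairs among the (x_m , y_m) and obtaining a list of
-- length ℓ + 1.

module Submission where

open import Defs
open import Data.Nat using (ℕ; suc; _≤_; _<_; _+_; _*_; z≤n; s≤s)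
open import Data.Nat.Properties
open import Data.Fin using (Fin; zero; suc) renaming (_≟_ to _≟ᶠ_)
open import Data.Fin.Properties using (any?; all?; ¬∀⟶∃¬)
open import Data.Fin.Subset using (Subset; _∈_; _∉_; ∣_∣; inside; outside; ⁅_⁆; _-_; _⊆_)
open import Data.Fin.Subset.Properties
  using (_∈?_; x∈⁅y⁆⇔x≡y; ∣⁅x⁆∣≡1; drop-there; p─q⊆p; x∈p∧x≢y⇒x∈p-y; x∈p⇒∣p-x∣<∣p∣;
         nonempty?; Empty-unique; ∣⊥∣≡0)
import Data.Vec.Base as Vec
open import Data.List using (List; []; _∷_; length; map; filter; _++_; allFin; tabulate)
open import Data.List.Properties using (length-map; length-++; length-tabulate; length-filter; filter-notAll)
open import Data.List.Relation.Unary.All using (All; []; _∷_)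
import Data.List.Relation.Unary.All as All
import Data.List.Relation.Unary.All.Properties as Allₚ
open import Data.List.Relation.Unary.Any using (here; there)
import Data.List.Relation.Unary.Any as Any
open import Data.List.Relation.Unary.AllPairs using (AllPairs; []; _∷_)
import Data.List.Relation.Unary.AllPairs as AllPairs
import Data.List.Relation.Unary.AllPairs.Properties as AllPairsₚ
open import Data.List.Relation.Unary.Unique.Propositional using (Unique)
import Data.List.Relation.Unary.Unique.Propositional.Properties as Uniqueₚ
open import Data.List.Membership.Propositional using () renaming (_∈_ to _∈ˡ_)
open import Data.List.Membership.Propositional.Properties using (∈-filter⁺; ∈-filter⁻; ∈-allFin; ∈-map⁺; ∈-++⁻)
open import Data.List.Relation.Binary.Subset.Propositional using () renaming (_⊆_ to _⊆ˡ_)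
open import Data.Product using (_×_; ∃; _,_; proj₁; proj₂)
open import Data.Sum using (_⊎_; inj₁; inj₂; [_,_]; [_,_]′)
import Data.Sum as Sum
open import Data.Unit using (⊤; tt)
open import Data.Empty using (⊥; ⊥-elim)
open import Relation.Nullary using (¬_; Dec; yes; no; ¬?; contradiction)
open import Relation.Nullary.Decidable using (_×-dec_; _⊎-dec_; _→-dec_)
open import Relation.Unary using (Pred; Decidable)
open import Relation.Unary.Properties using (∁?)
open import Relation.Binary.Definitions using (DecidableEquality)
open import Relation.Binary.PropositionalEquality
  using (_≡_; _≢_; refl; sym; trans; cong; cong₂; subst; ≢-sym; module ≡-Reasoning)
open import Function using (_∘_; id)
open import Function.Bundles using (_⇔_; mk⇔; Equivalence)
open Equivalence using (to; from)

module _ {a p} {A : Set a} {P : Pred A p} (P? : Decidable P) where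

  length-filter+length-filter-∁ : ∀ xs →
    length (filter P? xs) + length (filter (∁? P?) xs) ≡ length xs
  length-filter+length-filter-∁ [] = refl
  length-filter+length-filter-∁ (x ∷ xs) with P? x
  ... | yes _ = cong suc (length-filter+length-filter-∁ xs)
  ... | no  _ = trans (+-suc _ _) (cong suc (length-filter+length-filter-∁ xs))

  private
    ⇔-drop : ∀ {m s} {f : Fin (suc m) → A} {S : Subset m} →
      (∀ i → P (f i) ⇔ i ∈ s Vec.∷ S) → ∀ i → P (f (suc i)) ⇔ i ∈ S
    ⇔-drop P⇔S i = mk⇔ (drop-there ∘ to (P⇔S (suc i))) (from (P⇔S (suc i)) ∘ Vec.there)

  length-filter-tabulate : ∀ {m} (f : Fin m → A) (S : Subset m) →
    (∀ i → P (f i) ⇔ i ∈ S) → length (filter P? (tabulate f)) ≡ ∣ S ∣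
  length-filter-tabulate f Vec.[] _ = refl
  length-filter-tabulate f (inside Vec.∷ S) P⇔S with P? (f zero)
  ... | yes _  = cong suc (length-filter-tabulate (f ∘ suc) S (⇔-drop P⇔S))
  ... | no ¬P₀ = contradiction (from (P⇔S zero) Vec.here) ¬P₀
  length-filter-tabulate f (outside Vec.∷ S) P⇔S with P? (f zero)
  ... | yes P₀ = contradiction (to (P⇔S zero) P₀) λ ()
  ... | no _   = length-filter-tabulate (f ∘ suc) S (⇔-drop P⇔S)

module _ {m : ℕ} where

  length-allFin : length (allFin m) ≡ m
  length-allFin = length-tabulate id

  length-filter-∈-allFin : (S : Subset m) → length (filter (_∈? S) (allFin m)) ≡ ∣ S ∣
  length-filter-∈-allFin S = length-filter-tabulate (_∈? S) id S (λ _ → mk⇔ id id)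

  ∣p∣+length-filter-∉-allFin : (S : Subset m) →
    ∣ S ∣ + length (filter (∁? (_∈? S)) (allFin m)) ≡ m
  ∣p∣+length-filter-∉-allFin S = begin
    ∣ S ∣ + length (filter (∁? (_∈? S)) (allFin m))
      ≡⟨ cong (_+ length (filter (∁? (_∈? S)) (allFin m))) (sym (length-filter-∈-allFin S)) ⟩
    length (filter (_∈? S) (allFin m)) + length (filter (∁? (_∈? S)) (allFin m))
      ≡⟨ length-filter+length-filter-∁ (_∈? S) (allFin m) ⟩
    length (allFin m)
      ≡⟨ length-allFin ⟩
    m ∎
    where open ≡-Reasoning

  filter-allFin-Unique : ∀ {p} {P : Pred (Fin m) p} (P? : Decidable P) → Unique (filter P? (allFin m))
  filter-allFin-Unique P? = Uniqueₚ.filter⁺ P? (Uniqueₚ.allFin⁺ m)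

  ∈-filter-allFin⁺ : ∀ {p} {P : Pred (Fin m) p} (P? : Decidable P) {i} → P i → i ∈ˡ filter P? (allFin m)
  ∈-filter-allFin⁺ P? = ∈-filter⁺ P? (∈-allFin _)

  ∈-filter-allFin⁻ : ∀ {p} {P : Pred (Fin m) p} (P? : Decidable P) {i} → i ∈ˡ filter P? (allFin m) → P i
  ∈-filter-allFin⁻ P? = proj₂ ∘ ∈-filter⁻ P? {xs = allFin m}

  allFinExcept : Fin m → List (Fin m)
  allFinExcept i = filter (∁? (_∈? ⁅ i ⁆)) (allFin m)

  ∈-allFinExcept⁻ : ∀ {i j} → j ∈ˡ allFinExcept i → j ≢ i
  ∈-allFinExcept⁻ j∈ = ∈-filter-allFin⁻ (∁? (_∈? ⁅ _ ⁆)) j∈ ∘ from x∈⁅y⁆⇔x≡y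

  length-allFinExcept : (i : Fin m) → suc (length (allFinExcept i)) ≡ m
  length-allFinExcept i =
    subst (λ s → s + length (allFinExcept i) ≡ m) (∣⁅x⁆∣≡1 i) (∣p∣+length-filter-∉-allFin ⁅ i ⁆)

module _ {a} {A : Set a} (_≟_ : DecidableEquality A) where

  Unique-length≤ : ∀ {xs ys : List A} → Unique xs → xs ⊆ˡ ys → length xs ≤ length ys
  Unique-length≤ {[]} _ _ = z≤n
  Unique-length≤ {x ∷ xs} {ys} (x∉xs ∷ !xs) xs⊆ys = begin-strict
    length xs                       ≤⟨ Unique-length≤ !xs xs⊆ys-x ⟩
    length (filter (∁? (_≟ x)) ys)  <⟨ filter-notAll (∁? (_≟ x)) ys x∈ys ⟩
    length ys                       ∎
    where
      open ≤-Reasoning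
      xs⊆ys-x : xs ⊆ˡ filter (∁? (_≟ x)) ys
      xs⊆ys-x z∈xs = ∈-filter⁺ (∁? (_≟ x)) (xs⊆ys (there z∈xs)) (All.lookup x∉xs z∈xs ∘ sym)
      x∈ys : Any.Any (λ z → ¬ z ≢ x) ys
      x∈ys = Any.map (λ x≡z z≢x → z≢x (sym x≡z)) (xs⊆ys (here refl))

Unique⇒AllPairs : ∀ {a r} {A : Set a} {R : A → A → Set r} {xs : List A} → Unique xs →
  (∀ {u v} → u ∈ˡ xs → v ∈ˡ xs → u ≢ v → R u v) → AllPairs R xs
Unique⇒AllPairs {xs = []} _ _ = []
Unique⇒AllPairs {xs = x ∷ xs} (x∉xs ∷ !xs) R-distinct =
  All.tabulate (λ v∈xs → R-distinct (here refl) (there v∈xs) (All.lookup x∉xs v∈xs))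
  ∷ Unique⇒AllPairs !xs (λ u∈ v∈ → R-distinct (there u∈) (there v∈))

module _ {m : ℕ} where

  1≤∣p∣ : ∀ {S : Subset m} {i} → i ∈ S → 1 ≤ ∣ S ∣
  1≤∣p∣ i∈S = ≤-trans (s≤s z≤n) (x∈p⇒∣p-x∣<∣p∣ i∈S)

  p-x≢p : ∀ {S : Subset m} {i} → i ∈ S → S - i ≢ S
  p-x≢p i∈S S-i≡S = <-irrefl (cong ∣_∣ S-i≡S) (x∈p⇒∣p-x∣<∣p∣ i∈S)

  module _ {S : Subset m} {P : Fin m → Set} (S-rep : Represents P S) where

    represents-1≤ : ¬ (∀ i → ¬ P i) → 1 ≤ ∣ S ∣
    represents-1≤ ¬none with nonempty? S
    ... | yes (_ , i∈S) = 1≤∣p∣ i∈S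
    ... | no empty = contradiction (λ i Pi → empty (i , from (S-rep i) Pi)) ¬none

    represents-single : ∣ S ∣ ≡ 1 → ∃ λ i → P i × (∀ j → P j → j ≡ i)
    represents-single ∣S∣≡1 with nonempty? S
    ... | no empty = contradiction (trans (sym ∣S∣≡1) (trans (cong ∣_∣ (Empty-unique empty)) (∣⊥∣≡0 m))) λ ()
    ... | yes (i , i∈S) = i , to (S-rep i) i∈S , only
      where
        only : ∀ j → P j → j ≡ i
        only j Pj with j ≟ᶠ i
        ... | yes j≡i = j≡i
        ... | no j≢i = contradiction
          (≤-trans (s≤s (1≤∣p∣ (x∈p∧x≢y⇒x∈p-y (from (S-rep j) Pj) j≢i)))
                   (subst (∣ S - i ∣ <_) ∣S∣≡1 (x∈p⇒∣p-x∣<∣p∣ i∈S)))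
          1+n≰n

subsetChoice : ∀ {m b r} {B : Set b} {R : Fin m → B → Set r} (S : Subset m) → (Fin m → B) →
  (∀ {i} → i ∈ S → ∃ (R i)) → ∃ λ (f : Fin m → B) → ∀ {i} → i ∈ S → R i (f i)
subsetChoice {m} {B = B} {R} S default pick = f , f-spec
  where
    f : Fin m → B
    f i with i ∈? S
    ... | yes i∈S = proj₁ (pick i∈S)
    ... | no _    = default i
    f-spec : ∀ {i} → i ∈ S → R i (f i)
    f-spec {i} i∈S with i ∈? S
    ... | yes i∈S′ = proj₂ (pick i∈S′)
    ... | no i∉S   = contradiction i∈S i∉S

minimal⇒¬-minus : ∀ {m p} {P : Pred (Subset m) p} {T : Subset m} →
  (∀ S → S ⊆ T → S ≢ T → ¬ P S) → ∀ {t} → t ∈ T → ¬ P (T - t)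
minimal⇒¬-minus minimal t∈T = minimal _ (p─q⊆p _ _) (p-x≢p t∈T)

module _ {m n q r} {Q : Pred (Fin n) q} {R : Fin n → Fin m → Set r}
         (Q? : Decidable Q) (R? : ∀ v j → Dec (R v j)) where

  essential⇒private : ∀ {T : Subset m} {t} → t ∈ T
    → (∀ v → Q v → ∃ λ j → j ∈ T × R v j)
    → ¬ (∀ v → Q v → ∃ λ j → j ∈ T - t × R v j)
    → ∃ λ v → Q v × R v t × (∀ j → j ∈ T → R v j → j ≡ t)
  essential⇒private {T} {t} t∈T covered uncovered
    with ¬∀⟶∃¬ n _ (λ v → Q? v →-dec any? (λ j → (j ∈? (T - t)) ×-dec R? v j)) uncovered
  ... | v , v-uncovered with Q? v
  ...   | no ¬Qv = contradiction (λ Qv → contradiction Qv ¬Qv) v-uncovered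
  ...   | yes Qv with covered v Qv
  ...     | j , j∈T , Rvj = v , Qv , subst (R v) (only j j∈T Rvj) Rvj , only
    where
      only : ∀ j → j ∈ T → R v j → j ≡ t
      only j j∈T Rvj with j ≟ᶠ t
      ... | yes j≡t = j≡t
      ... | no j≢t = contradiction (λ _ → j , x∈p∧x≢y⇒x∈p-y j∈T j≢t , Rvj) v-uncovered

squeeze : ∀ {a b c k l m} → a + b ≤ k → c ≤ m → m ≤ l → 2 * l ≤ 2 * k →
  2 * k ≡ a + (c + b) → l ≡ k × m ≡ l
squeeze {a} {b} {c} {k} {l} {m} a+b≤k c≤m m≤l 2l≤2k 2k≡ =
  ≤-antisym l≤k (≤-trans k≤m m≤l) , ≤-antisym m≤l (≤-trans l≤k k≤m)
  where
    l≤k : l ≤ k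
    l≤k = *-cancelˡ-≤ 2 2l≤2k
    k+k≤k+m : k + k ≤ k + m
    k+k≤k+m = begin
      k + k            ≡⟨ cong (k +_) (sym (+-identityʳ k)) ⟩
      2 * k            ≡⟨ 2k≡ ⟩
      a + (c + b)      ≡⟨ cong (a +_) (+-comm c b) ⟩
      a + (b + c)      ≡⟨ sym (+-assoc a b c) ⟩
      a + b + c        ≤⟨ +-mono-≤ a+b≤k c≤m ⟩
      k + m            ∎
      where open ≤-Reasoning
    k≤m : k ≤ m
    k≤m = +-cancelˡ-≤ k k m k+k≤k+m

module WitnessedZSequences {n : ℕ} (G : Graph n) where
  open Graph G using (E; E?)

  Edge : Fin n × Fin n → Set
  Edge (v , w) = E v w

  FreshAfter : Fin n → Fin n × Fin n → Set
  FreshAfter u (v , w) = v ≢ u × ¬ InClosedNbhd G u w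

  Precedes : Fin n × Fin n → Fin n × Fin n → Set
  Precedes (u , _) = FreshAfter u

  Precedes? : ∀ c d → Dec (Precedes c d)
  Precedes? (u , _) (v , w) = ¬? (v ≟ᶠ u) ×-dec ¬? ((w ≟ᶠ u) ⊎-dec E? u w)

  IsWitnessed : List (Fin n × Fin n) → Set
  IsWitnessed cs = All Edge cs × AllPairs Precedes cs

  witnessed-++ : ∀ {cs ds} → IsWitnessed cs → IsWitnessed ds →
    All (λ c → All (Precedes c) ds) cs → IsWitnessed (cs ++ ds)
  witnessed-++ (cs-edges , cs-pairs) (ds-edges , ds-pairs) cross =
    Allₚ.++⁺ cs-edges ds-edges , AllPairsₚ.++⁺ cs-pairs ds-pairs cross

  private
    FreshAfterAll : List (Fin n) → List (Fin n × Fin n) → Set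
    FreshAfterAll prev = All (λ c → All (λ u → FreshAfter u c) prev)

    witnessed⇒ZSeqFrom : ∀ prev cs → IsWitnessed cs → FreshAfterAll prev cs →
      ZSeqFrom G (λ _ → ⊤) prev (map proj₁ cs)
    witnessed⇒ZSeqFrom prev [] _ _ = tt
    witnessed⇒ZSeqFrom prev ((v , w) ∷ cs) (Evw ∷ edges , v-first ∷ pairs) (fresh ∷ fresh*) =
      tt , All.map proj₁ fresh , (w , tt , Evw , All.map proj₂ fresh) ,
      witnessed⇒ZSeqFrom (v ∷ prev) cs (edges , pairs)
        (All.zipWith (λ (p , q) → p ∷ q) (v-first , fresh*))

    ZSeqFrom⇒witnessed : ∀ X prev vs → ZSeqFrom G X prev vs →
      ∃ λ cs → map proj₁ cs ≡ vs × IsWitnessed cs × FreshAfterAll prev cs × All (X ∘ proj₁) cs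
    ZSeqFrom⇒witnessed X prev [] _ = [] , refl , ([] , []) , [] , []
    ZSeqFrom⇒witnessed X prev (v ∷ vs) (Xv , v-new , (w , _ , Evw , w-new) , rest)
      with ZSeqFrom⇒witnessed X (v ∷ prev) vs rest
    ... | cs , refl , (edges , pairs) , fresh , inX =
      (v , w) ∷ cs , refl , (Evw ∷ edges , All.map All.head fresh ∷ pairs) ,
      All.zip (v-new , w-new) ∷ All.map All.tail fresh , Xv ∷ inX

  witnessed⇒ZSeq : ∀ {cs} → IsWitnessed cs → IsZSeq G (λ _ → ⊤) (map proj₁ cs)
  witnessed⇒ZSeq w = witnessed⇒ZSeqFrom [] _ w (All.universal (λ _ → []) _)

  ZSeq⇒witnessed : ∀ {X vs} → IsZSeq G X vs →
    ∃ λ cs → length cs ≡ length vs × IsWitnessed cs × All (X ∘ proj₁) cs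
  ZSeq⇒witnessed {X} {vs} zseq with ZSeqFrom⇒witnessed X [] vs zseq
  ... | cs , refl , w , _ , inX = cs , sym (length-map proj₁ cs) , w , inX

  witnessed-length≤ : ∀ {k cs} → IsGammaZ G (λ _ → ⊤) k → IsWitnessed cs → length cs ≤ k
  witnessed-length≤ {cs = cs} (_ , longest) w =
    subst (_≤ _) (length-map proj₁ cs) (longest _ (witnessed⇒ZSeq w))

module Extremal {n : ℕ} (G : Graph n) (D : Subset n) (D-max : IsMaxMinimalTD G D)
  (k : ℕ) (γᶻ≡k : IsGammaZ G (λ _ → ⊤) k) (∣D∣≡2k : ∣ D ∣ ≡ 2 * k)
  (ℓ : ℕ) (x y : Fin ℓ → Fin n) (components : IsK2Enumeration G D ℓ x y) where

  open Graph G using (E; E?; irrefl) renaming (sym to E-sym)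
  open WitnessedZSequences G

  x∈D : ∀ i → x i ∈ D
  x∈D i = proj₁ (proj₁ components i)

  y∈D : ∀ i → y i ∈ D
  y∈D i = proj₁ (proj₂ (proj₁ components i))

  E-xy : ∀ i → E (x i) (y i)
  E-xy i = proj₁ (proj₂ (proj₂ (proj₁ components i)))

  x-only : ∀ i z → z ∈ D → E (x i) z → z ≡ y i
  x-only i = proj₁ (proj₂ (proj₂ (proj₂ (proj₁ components i))))

  y-only : ∀ i z → z ∈ D → E (y i) z → z ≡ x i
  y-only i = proj₂ (proj₂ (proj₂ (proj₂ (proj₁ components i))))

  x-injective : ∀ {i j} → x i ≡ x j → i ≡ j
  x-injective {i} {j} xi≡xj = proj₁ (proj₂ components) i j (inj₁ xi≡xj)

  x≢y : ∀ i j → x i ≢ y j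
  x≢y i j xi≡yj with proj₁ (proj₂ components) i j (inj₂ xi≡yj)
  ... | refl = irrefl (subst (E (x i)) (sym xi≡yj) (E-xy i))

  y-injective : ∀ {i j} → y i ≡ y j → i ≡ j
  y-injective {i} {j} yi≡yj =
    x-injective (y-only j (x i) (x∈D i) (subst (λ z → E z (x i)) yi≡yj (E-sym (E-xy i))))

  outside-D⇒≢x : ∀ {u} m → u ∉ D → u ≢ x m
  outside-D⇒≢x m u∉D u≡xm = u∉D (subst (_∈ D) (sym u≡xm) (x∈D m))

  -- Private neighbours: part (i)

  Private : Fin n → Fin n → Set
  Private d w = E w d × (∀ d' → d' ∈ D → E w d' → d' ≡ d)

  Private? : ∀ d w → Dec (Private d w)
  Private? d w = E? w d ×-dec all? (λ d' → d' ∈? D →-dec (E? w d' →-dec d' ≟ᶠ d))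

  private-unique : ∀ {d e w} → Private d w → Private e w → e ∈ D → e ≡ d
  private-unique (_ , only) (Ewe , _) e∈D = only _ e∈D Ewe

  private-neighbour : ∀ {d} → d ∈ D → ∃ (Private d)
  private-neighbour d∈D
    with essential⇒private (λ _ → yes tt) E? d∈D (λ v _ → D-td v)
           (λ covered → minimal⇒¬-minus D-minimal d∈D (λ v → covered v tt))
    where
      D-td : IsTD G D
      D-td = proj₁ (proj₁ D-max)
      D-minimal : ∀ S → S ⊆ D → S ≢ D → ¬ IsTD G S
      D-minimal = proj₂ (proj₁ D-max)
  ... | w , _ , Ewd , only = w , Ewd , only

  External : Fin n → Set
  External d = ∃ λ w → w ∉ D × Private d w

  External? : ∀ d → Dec (External d)
  External? d = any? (λ w → ¬? (w ∈? D) ×-dec Private? d w)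

  chosenPrivate-choice : ∃ λ (pn : Fin n → Fin n) →
    ∀ {d} → d ∈ D → Private d (pn d) × (External d → pn d ∉ D)
  chosenPrivate-choice = subsetChoice D id pick
    where
      pick : ∀ {d} → d ∈ D → ∃ λ w → Private d w × (External d → w ∉ D)
      pick {d} d∈D with External? d
      ... | yes (w , w∉D , pw) = w , pw , λ _ → w∉D
      ... | no ¬external =
        let (w , pw) = private-neighbour d∈D in w , pw , λ external → contradiction external ¬external

  chosenPrivate : Fin n → Fin n
  chosenPrivate = proj₁ chosenPrivate-choice

  chosenPrivate-private : ∀ {d} → d ∈ D → Private d (chosenPrivate d)
  chosenPrivate-private = proj₁ ∘ proj₂ chosenPrivate-choice

  chosenPrivate-external : ∀ {d} → d ∈ D → External d → chosenPrivate d ∉ D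
  chosenPrivate-external = proj₂ ∘ proj₂ chosenPrivate-choice

  chosenPrivate-internal : ∀ {d} → d ∈ D → ¬ External d → chosenPrivate d ∈ D
  chosenPrivate-internal {d} d∈D ¬external with chosenPrivate d ∈? D
  ... | yes w∈D = w∈D
  ... | no w∉D  = contradiction (chosenPrivate d , w∉D , chosenPrivate-private d∈D) ¬external

  Mutual : Fin ℓ → Set
  Mutual i = ¬ External (x i) × ¬ External (y i)

  Mutual? : ∀ i → Dec (Mutual i)
  Mutual? i = ¬? (External? (x i)) ×-dec ¬? (External? (y i))

  Dropped : Fin n → Set
  Dropped d = ∃ λ i → d ≡ y i × Mutual i

  Dropped? : ∀ d → Dec (Dropped d)
  Dropped? d = any? (λ i → (d ≟ᶠ y i) ×-dec Mutual? i)

  -- two internal vertices that are each other's chosen private neighbours form a K2-component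
  mutual-private⇒dropped : ∀ {d e} → d ∈ D → e ∈ D → ¬ External d → ¬ External e →
    d ≡ chosenPrivate e → Dropped d ⊎ Dropped e
  mutual-private⇒dropped {d} {e} d∈D e∈D ¬ext-d ¬ext-e d≡pe
    with proj₂ (proj₂ components) d e (d∈D , e∈D , E-de , only-e , only-d)
    where
      private-e-d : Private e d
      private-e-d = subst (Private e) (sym d≡pe) (chosenPrivate-private e∈D)
      E-de : E d e
      E-de = proj₁ private-e-d
      only-e : ∀ z → z ∈ D → E d z → z ≡ e
      only-e = proj₂ private-e-d
      pd≡e : chosenPrivate d ≡ e
      pd≡e = only-e _ (chosenPrivate-internal d∈D ¬ext-d) (E-sym (proj₁ (chosenPrivate-private d∈D)))
      only-d : ∀ z → z ∈ D → E e z → z ≡ d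
      only-d = proj₂ (subst (Private d) pd≡e (chosenPrivate-private d∈D))
  ... | i , inj₁ (refl , refl) = inj₂ (i , refl , ¬ext-d , ¬ext-e)
  ... | i , inj₂ (refl , refl) = inj₁ (i , refl , ¬ext-e , ¬ext-d)

  privatePair : Fin n → Fin n × Fin n
  privatePair d = chosenPrivate d , d

  privatePair-precedes : ∀ {d e} → d ∈ D → e ∈ D → e ≢ d → d ≢ chosenPrivate e →
    Precedes (privatePair e) (privatePair d)
  privatePair-precedes {d} {e} d∈D e∈D e≢d d≢pe =
      (λ pd≡pe → e≢d (private-unique (chosenPrivate-private d∈D)
                        (subst (Private e) (sym pd≡pe) (chosenPrivate-private e∈D)) e∈D))
    , [ d≢pe , (λ Epe-d → e≢d (sym (proj₂ (chosenPrivate-private e∈D) d d∈D Epe-d))) ]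

  Dlist externals internals kept dropped : List (Fin n)
  Dlist = filter (_∈? D) (allFin n)
  externals = filter External? Dlist
  internals = filter (∁? External?) Dlist
  kept = filter (∁? Dropped?) internals
  dropped = filter Dropped? internals

  mutuals : List (Fin ℓ)
  mutuals = filter Mutual? (allFin ℓ)

  ∈externals⁻ : ∀ {d} → d ∈ˡ externals → d ∈ D × External d
  ∈externals⁻ d∈ = let (d∈Dl , ext) = ∈-filter⁻ External? {xs = Dlist} d∈
                   in ∈-filter-allFin⁻ (_∈? D) d∈Dl , ext

  ∈internals⁻ : ∀ {d} → d ∈ˡ internals → d ∈ D × ¬ External d
  ∈internals⁻ d∈ = let (d∈Dl , ¬ext) = ∈-filter⁻ (∁? External?) {xs = Dlist} d∈
                   in ∈-filter-allFin⁻ (_∈? D) d∈Dl , ¬ext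

  ∈kept⁻ : ∀ {d} → d ∈ˡ kept → d ∈ D × ¬ External d × ¬ Dropped d
  ∈kept⁻ d∈ = let (d∈int , ¬dropped) = ∈-filter⁻ (∁? Dropped?) {xs = internals} d∈
                  (d∈D , ¬ext) = ∈internals⁻ d∈int
              in d∈D , ¬ext , ¬dropped

  Dlist-Unique : Unique Dlist
  Dlist-Unique = filter-allFin-Unique (_∈? D)

  -- externals first: their private neighbours lie outside D, so no later vertex can be one
  privatePairs-witnessed : IsWitnessed (map privatePair (externals ++ kept))
  privatePairs-witnessed =
      Allₚ.map⁺ (All.tabulate (λ d∈ → proj₁ (chosenPrivate-private (∈D d∈))))
    , AllPairsₚ.map⁺ (AllPairsₚ.++⁺
        (Unique⇒AllPairs (Uniqueₚ.filter⁺ External? Dlist-Unique) external-pairs)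
        (Unique⇒AllPairs (Uniqueₚ.filter⁺ (∁? Dropped?) (Uniqueₚ.filter⁺ (∁? External?) Dlist-Unique))
           kept-pairs)
        (All.tabulate (λ e∈ → All.tabulate (λ d∈ → external-kept e∈ d∈))))
    where
      ∈D : ∀ {d} → d ∈ˡ externals ++ kept → d ∈ D
      ∈D d∈ = [ proj₁ ∘ ∈externals⁻ , proj₁ ∘ ∈kept⁻ ] (∈-++⁻ externals d∈)
      external-pairs : ∀ {e d} → e ∈ˡ externals → d ∈ˡ externals → e ≢ d →
        Precedes (privatePair e) (privatePair d)
      external-pairs e∈ d∈ e≢d =
        let (e∈D , ext-e) = ∈externals⁻ e∈ ; (d∈D , _) = ∈externals⁻ d∈
        in privatePair-precedes d∈D e∈D e≢d
             (λ d≡pe → chosenPrivate-external e∈D ext-e (subst (_∈ D) d≡pe d∈D))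
      kept-pairs : ∀ {e d} → e ∈ˡ kept → d ∈ˡ kept → e ≢ d →
        Precedes (privatePair e) (privatePair d)
      kept-pairs e∈ d∈ e≢d =
        let (e∈D , ¬ext-e , ¬dr-e) = ∈kept⁻ e∈ ; (d∈D , ¬ext-d , ¬dr-d) = ∈kept⁻ d∈
        in privatePair-precedes d∈D e∈D e≢d
             (λ d≡pe → [ ¬dr-d , ¬dr-e ] (mutual-private⇒dropped d∈D e∈D ¬ext-d ¬ext-e d≡pe))
      external-kept : ∀ {e d} → e ∈ˡ externals → d ∈ˡ kept →
        Precedes (privatePair e) (privatePair d)
      external-kept e∈ d∈ =
        let (e∈D , ext-e) = ∈externals⁻ e∈ ; (d∈D , ¬ext-d , _) = ∈kept⁻ d∈
        in privatePair-precedes d∈D e∈D (λ e≡d → ¬ext-d (subst External e≡d ext-e))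
             (λ d≡pe → chosenPrivate-external e∈D ext-e (subst (_∈ D) d≡pe d∈D))

  externals+kept≤k : length externals + length kept ≤ k
  externals+kept≤k = subst (_≤ k)
    (trans (length-map privatePair (externals ++ kept)) (length-++ externals))
    (witnessed-length≤ γᶻ≡k privatePairs-witnessed)

  dropped≤mutuals : length dropped ≤ length mutuals
  dropped≤mutuals = subst (length dropped ≤_) (length-map y mutuals)
    (Unique-length≤ _≟ᶠ_
      (Uniqueₚ.filter⁺ Dropped? (Uniqueₚ.filter⁺ (∁? External?) Dlist-Unique))
      (λ d∈ → let (i , d≡yi , mutual-i) = proj₂ (∈-filter⁻ Dropped? {xs = internals} d∈)
              in subst (_∈ˡ map y mutuals) (sym d≡yi) (∈-map⁺ y (∈-filter-allFin⁺ Mutual? mutual-i))))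

  mutuals≤ℓ : length mutuals ≤ ℓ
  mutuals≤ℓ = subst (length mutuals ≤_) length-allFin (length-filter Mutual? (allFin ℓ))

  endpoints : List (Fin ℓ) → List (Fin n)
  endpoints [] = []
  endpoints (i ∷ is) = x i ∷ y i ∷ endpoints is

  length-endpoints : ∀ is → length (endpoints is) ≡ 2 * length is
  length-endpoints [] = refl
  length-endpoints (i ∷ is) =
    trans (cong (2 +_) (length-endpoints is)) (sym (*-suc 2 (length is)))

  ∈-endpoints⁻ : ∀ {z} is → z ∈ˡ endpoints is → ∃ λ i → i ∈ˡ is × (z ≡ x i ⊎ z ≡ y i)
  ∈-endpoints⁻ (i ∷ is) (here z≡xi) = i , here refl , inj₁ z≡xi
  ∈-endpoints⁻ (i ∷ is) (there (here z≡yi)) = i , here refl , inj₂ z≡yi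
  ∈-endpoints⁻ (i ∷ is) (there (there z∈)) =
    let (j , j∈ , z≡) = ∈-endpoints⁻ is z∈ in j , there j∈ , z≡

  endpoints-Unique : ∀ is → Unique is → Unique (endpoints is)
  endpoints-Unique [] _ = []
  endpoints-Unique (i ∷ is) (i∉is ∷ !is) =
    (x≢y i i ∷ All.tabulate x-fresh) ∷ All.tabulate y-fresh ∷ endpoints-Unique is !is
    where
      x-fresh : ∀ {z} → z ∈ˡ endpoints is → x i ≢ z
      x-fresh z∈ xi≡z with ∈-endpoints⁻ is z∈
      ... | j , j∈ , inj₁ z≡xj = All.lookup i∉is j∈ (x-injective (trans xi≡z z≡xj))
      ... | j , j∈ , inj₂ z≡yj = x≢y i j (trans xi≡z z≡yj)
      y-fresh : ∀ {z} → z ∈ˡ endpoints is → y i ≢ z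
      y-fresh z∈ yi≡z with ∈-endpoints⁻ is z∈
      ... | j , j∈ , inj₁ z≡xj = x≢y j i (sym (trans yi≡z z≡xj))
      ... | j , j∈ , inj₂ z≡yj = All.lookup i∉is j∈ (y-injective (trans yi≡z z≡yj))

  endpoints-allFin-Unique : Unique (endpoints (allFin ℓ))
  endpoints-allFin-Unique = endpoints-Unique (allFin ℓ) (Uniqueₚ.allFin⁺ ℓ)

  length-endpoints-allFin : length (endpoints (allFin ℓ)) ≡ 2 * ℓ
  length-endpoints-allFin = trans (length-endpoints (allFin ℓ)) (cong (2 *_) (length-allFin {ℓ}))

  endpoints⊆Dlist : endpoints (allFin ℓ) ⊆ˡ Dlist
  endpoints⊆Dlist z∈ with ∈-endpoints⁻ (allFin ℓ) z∈
  ... | i , _ , inj₁ refl = ∈-filter-allFin⁺ (_∈? D) (x∈D i)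
  ... | i , _ , inj₂ refl = ∈-filter-allFin⁺ (_∈? D) (y∈D i)

  2ℓ≤∣D∣ : 2 * ℓ ≤ ∣ D ∣
  2ℓ≤∣D∣ = begin
    2 * ℓ                           ≡⟨ sym length-endpoints-allFin ⟩
    length (endpoints (allFin ℓ))   ≤⟨ Unique-length≤ _≟ᶠ_ endpoints-allFin-Unique endpoints⊆Dlist ⟩
    length Dlist                    ≡⟨ length-filter-∈-allFin D ⟩
    ∣ D ∣                           ∎
    where open ≤-Reasoning

  ∣D∣≡externals+dropped+kept : ∣ D ∣ ≡ length externals + (length dropped + length kept)
  ∣D∣≡externals+dropped+kept = begin
    ∣ D ∣
      ≡⟨ sym (length-filter-∈-allFin D) ⟩
    length Dlist
      ≡⟨ sym (length-filter+length-filter-∁ External? Dlist) ⟩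
    length externals + length internals
      ≡⟨ cong (length externals +_) (sym (length-filter+length-filter-∁ Dropped? internals)) ⟩
    length externals + (length dropped + length kept) ∎
    where open ≡-Reasoning

  ℓ≡k×mutuals≡ℓ : ℓ ≡ k × length mutuals ≡ ℓ
  ℓ≡k×mutuals≡ℓ = squeeze {length externals} {length kept} externals+kept≤k dropped≤mutuals mutuals≤ℓ
    (subst (2 * ℓ ≤_) ∣D∣≡2k 2ℓ≤∣D∣) (trans (sym ∣D∣≡2k) ∣D∣≡externals+dropped+kept)

  ℓ≡k : ℓ ≡ k
  ℓ≡k = proj₁ ℓ≡k×mutuals≡ℓ

  ∣D∣≡2ℓ : ∣ D ∣ ≡ 2 * ℓ
  ∣D∣≡2ℓ = trans ∣D∣≡2k (cong (2 *_) (sym ℓ≡k))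

  all-mutual : ∀ i → Mutual i
  all-mutual i with Mutual? i
  ... | yes mutual-i = mutual-i
  ... | no ¬mutual-i = contradiction
    (subst (length mutuals <_) length-allFin
      (filter-notAll Mutual? (allFin ℓ) (Any.map (λ { refl → ¬mutual-i }) (∈-allFin i))))
    (<-irrefl (proj₂ ℓ≡k×mutuals≡ℓ))

  D⊆endpoints : ∀ v → v ∈ D → ∃ λ i → v ≡ x i ⊎ v ≡ y i
  D⊆endpoints v v∈D with any? (λ i → (v ≟ᶠ x i) ⊎-dec (v ≟ᶠ y i))
  ... | yes found = found
  ... | no ¬found = contradiction (begin
      suc (2 * ℓ)                          ≡⟨ cong suc (sym length-endpoints-allFin) ⟩
      length (v ∷ endpoints (allFin ℓ))    ≤⟨ Unique-length≤ _≟ᶠ_ (All.tabulate v-fresh ∷ endpoints-allFin-Unique) ⊆Dlist ⟩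
      length Dlist                         ≡⟨ length-filter-∈-allFin D ⟩
      ∣ D ∣                                ≡⟨ ∣D∣≡2ℓ ⟩
      2 * ℓ                                ∎) 1+n≰n
    where
      open ≤-Reasoning
      v-fresh : ∀ {z} → z ∈ˡ endpoints (allFin ℓ) → v ≢ z
      v-fresh z∈ v≡z = let (i , _ , z≡) = ∈-endpoints⁻ (allFin ℓ) z∈
                       in ¬found (i , Sum.map (trans v≡z) (trans v≡z) z≡)
      ⊆Dlist : v ∷ endpoints (allFin ℓ) ⊆ˡ Dlist
      ⊆Dlist (here refl) = ∈-filter-allFin⁺ (_∈? D) v∈D
      ⊆Dlist (there z∈) = endpoints⊆Dlist z∈

  -- The sets A_i(D): parts (ii)–(v)

  A : Fin ℓ → Fin n → Set
  A = InA G D x y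

  A-neighbour-in-D : ∀ {i w} → A i w → ∀ d → d ∈ D → E w d → d ≡ x i ⊎ d ≡ y i
  A-neighbour-in-D {i} (_ , no-other) d d∈D Ewd with d ≟ᶠ x i | d ≟ᶠ y i
  ... | yes d≡xi | _        = inj₁ d≡xi
  ... | no _     | yes d≡yi = inj₂ d≡yi
  ... | no d≢xi  | no d≢yi  = contradiction Ewd (no-other d d∈D d≢xi d≢yi)

  A-outside-adjacent-both : ∀ {i w} → A i w → w ∉ D → E w (x i) × E w (y i)
  A-outside-adjacent-both {i} {w} w∈A w∉D with E? w (x i) | E? w (y i)
  ... | yes Ewx | yes Ewy = Ewx , Ewy
  ... | no ¬Ewx | no ¬Ewy = contradiction (proj₁ w∈A) [ ¬Ewx , ¬Ewy ]
  ... | yes Ewx | no ¬Ewy = contradiction (w , w∉D , Ewx , only-x) (proj₁ (all-mutual i))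
    where
      only-x : ∀ d → d ∈ D → E w d → d ≡ x i
      only-x d d∈D Ewd = [ id , (λ { refl → contradiction Ewd ¬Ewy }) ] (A-neighbour-in-D w∈A d d∈D Ewd)
  ... | no ¬Ewx | yes Ewy = contradiction (w , w∉D , Ewy , only-y) (proj₂ (all-mutual i))
    where
      only-y : ∀ d → d ∈ D → E w d → d ≡ y i
      only-y d d∈D Ewd = [ (λ { refl → contradiction Ewd ¬Ewx }) , id ] (A-neighbour-in-D w∈A d d∈D Ewd)

  A-cases : ∀ {i w} → A i w → w ≡ x i ⊎ w ≡ y i ⊎ (w ∉ D × E w (x i) × E w (y i))
  A-cases {i} {w} w∈A with w ∈? D
  ... | no w∉D  = inj₂ (inj₂ (w∉D , A-outside-adjacent-both w∈A w∉D))
  ... | yes w∈D = [ (λ Ewx → inj₂ (inj₁ (x-only i w w∈D (E-sym Ewx))))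
                  , (λ Ewy → inj₁ (y-only i w w∈D (E-sym Ewy))) ] (proj₁ w∈A)

  A-adjacent-x : ∀ {i w} → A i w → w ≢ x i → E w (x i)
  A-adjacent-x {i} w∈A w≢xi with A-cases w∈A
  ... | inj₁ w≡xi = contradiction w≡xi w≢xi
  ... | inj₂ (inj₁ refl) = E-sym (E-xy i)
  ... | inj₂ (inj₂ (_ , Ewx , _)) = Ewx

  A-adjacent-y : ∀ {i w} → A i w → w ≢ y i → E w (y i)
  A-adjacent-y {i} w∈A w≢yi with A-cases w∈A
  ... | inj₁ refl = E-xy i
  ... | inj₂ (inj₁ w≡yi) = contradiction w≡yi w≢yi
  ... | inj₂ (inj₂ (_ , _ , Ewy)) = Ewy

  x∈A : ∀ i → A i (x i)
  x∈A i = inj₂ (E-xy i) , λ d d∈D _ d≢yi Exd → d≢yi (x-only i d d∈D Exd)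

  y∈A : ∀ i → A i (y i)
  y∈A i = inj₁ (E-sym (E-xy i)) , λ d d∈D d≢xi _ Eyd → d≢xi (y-only i d d∈D Eyd)

  A-not-adjacent-other : ∀ {j u m} → A j u → m ≢ j → ¬ E u (x m) × ¬ E u (y m)
  A-not-adjacent-other {j} {u} {m} (_ , no-other) m≢j =
      no-other (x m) (x∈D m) (m≢j ∘ x-injective) (x≢y m j)
    , no-other (y m) (y∈D m) (x≢y j m ∘ sym) (m≢j ∘ y-injective)

  x∉A : ∀ {j m} → m ≢ j → ¬ A j (x m)
  x∉A {m = m} m≢j xm∈A = proj₂ (A-not-adjacent-other xm∈A m≢j) (E-xy m)

  A-not-near-x : ∀ {i w m} → A i w → m ≢ i → ¬ InClosedNbhd G (x m) w
  A-not-near-x w∈A m≢i (inj₁ refl) = x∉A m≢i w∈A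
  A-not-near-x w∈A m≢i (inj₂ Exw) = proj₁ (A-not-adjacent-other w∈A m≢i) (E-sym Exw)

  A-fresh : ∀ {j u m} → A j u → m ≢ j → FreshAfter u (x m , y m)
  A-fresh {u = u} {m} u∈A m≢j =
      (λ { refl → ¬Euy (E-xy m) })
    , [ (λ { refl → ¬Eux (E-sym (E-xy m)) }) , ¬Euy ]
    where
      ¬Eux : ¬ E u (x m)
      ¬Eux = proj₁ (A-not-adjacent-other u∈A m≢j)
      ¬Euy : ¬ E u (y m)
      ¬Euy = proj₂ (A-not-adjacent-other u∈A m≢j)

  xy : Fin ℓ → Fin n × Fin n
  xy m = x m , y m

  xy-precedes : ∀ {m m′} → m ≢ m′ → Precedes (xy m) (xy m′)
  xy-precedes m≢m′ = A-fresh (x∈A _) (m≢m′ ∘ sym)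

  Placeable : List (Fin n × Fin n) → Fin ℓ → Set
  Placeable cs m = All (Precedes (xy m)) cs ⊎ All (λ c → Precedes c (xy m)) cs

  module _ (L : List (Fin ℓ)) (cs : List (Fin n × Fin n)) where
    private
      Before : Pred (Fin ℓ) _
      Before m = All (Precedes (xy m)) cs
      before? : Decidable Before
      before? m = All.all? (Precedes? (xy m)) cs
      before after : List (Fin ℓ)
      before = filter before? L
      after = filter (∁? before?) L

    sandwich : List (Fin n × Fin n)
    sandwich = map xy before ++ cs ++ map xy after

    length-sandwich : length sandwich ≡ length L + length cs
    length-sandwich = begin
      length (map xy before ++ cs ++ map xy after)
        ≡⟨ length-++ (map xy before) ⟩
      length (map xy before) + length (cs ++ map xy after)
        ≡⟨ cong₂ _+_ (length-map xy before) (length-++ cs) ⟩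
      length before + (length cs + length (map xy after))
        ≡⟨ cong (λ l → length before + (length cs + l)) (length-map xy after) ⟩
      length before + (length cs + length after)
        ≡⟨ cong (length before +_) (+-comm (length cs) (length after)) ⟩
      length before + (length after + length cs)
        ≡⟨ sym (+-assoc (length before) (length after) (length cs)) ⟩
      length before + length after + length cs
        ≡⟨ cong (_+ length cs) (length-filter+length-filter-∁ before? L) ⟩
      length L + length cs ∎
      where open ≡-Reasoning

    sandwich-witnessed : Unique L → IsWitnessed cs →
      (∀ {m} → m ∈ˡ L → Placeable cs m) → IsWitnessed sandwich
    sandwich-witnessed !L cs-witnessed placed =
      witnessed-++ (block before?) (witnessed-++ cs-witnessed (block (∁? before?)) cs→after) before→rest
      where
        block : ∀ {p} {Q : Pred (Fin ℓ) p} (Q? : Decidable Q) → IsWitnessed (map xy (filter Q? L))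
        block Q? = Allₚ.map⁺ (All.universal E-xy _)
                 , AllPairsₚ.map⁺ (AllPairsₚ.filter⁺ Q? (AllPairs.map xy-precedes !L))
        cs→after : All (λ c → All (Precedes c) (map xy after)) cs
        cs→after = All.tabulate λ c∈ → Allₚ.map⁺ (All.tabulate λ m∈ →
          let (m∈L , ¬before) = ∈-filter⁻ (∁? before?) {xs = L} m∈
          in All.lookup ([ (λ b → contradiction b ¬before) , id ] (placed m∈L)) c∈)
        before→rest : All (λ b → All (Precedes b) (cs ++ map xy after)) (map xy before)
        before→rest = Allₚ.map⁺ (All.tabulate λ m∈ →
          let m-before = proj₂ (∈-filter⁻ before? {xs = L} m∈)
          in Allₚ.++⁺ m-before (Allₚ.map⁺ (All.tabulate λ m′∈ →
               xy-precedes (λ { refl → proj₂ (∈-filter⁻ (∁? before?) {xs = L} m′∈) m-before }))))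

  sandwich-bound : ∀ L → Unique L → ∀ cs → IsWitnessed cs →
    (∀ {m} → m ∈ˡ L → Placeable cs m) → length L + length cs ≤ ℓ
  sandwich-bound L !L cs cs-witnessed placed = begin
    length L + length cs     ≡⟨ sym (length-sandwich L cs) ⟩
    length (sandwich L cs)   ≤⟨ witnessed-length≤ γᶻ≡k (sandwich-witnessed L cs !L cs-witnessed placed) ⟩
    k                        ≡⟨ sym ℓ≡k ⟩
    ℓ                        ∎
    where open ≤-Reasoning

  no-pair-sandwich : ∀ i c d → Edge c → Edge d → Precedes c d →
    (∀ {m} → m ≢ i → Placeable (c ∷ d ∷ []) m) → ⊥
  no-pair-sandwich i c d Ec Ed c→d placed = 1+n≰n (begin
    suc ℓ                          ≡⟨ cong suc (sym (length-allFinExcept i)) ⟩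
    2 + length (allFinExcept i)    ≡⟨ +-comm 2 (length (allFinExcept i)) ⟩
    length (allFinExcept i) + 2    ≤⟨ sandwich-bound (allFinExcept i) (filter-allFin-Unique _) (c ∷ d ∷ [])
                                        ((Ec ∷ Ed ∷ []) , ((c→d ∷ []) ∷ [] ∷ []))
                                        (placed ∘ ∈-allFinExcept⁻) ⟩
    ℓ                              ∎)
    where open ≤-Reasoning

  no-edge-sandwich : ∀ c → Edge c → (∀ m → Placeable (c ∷ []) m) → ⊥
  no-edge-sandwich c Ec placed = 1+n≰n (begin
    suc ℓ                     ≡⟨ +-comm 1 ℓ ⟩
    ℓ + 1                     ≡⟨ cong (_+ 1) (sym length-allFin) ⟩
    length (allFin ℓ) + 1     ≤⟨ sandwich-bound (allFin ℓ) (Uniqueₚ.allFin⁺ ℓ) (c ∷ [])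
                                   ((Ec ∷ []) , ([] ∷ [])) (λ {m} _ → placed m) ⟩
    ℓ                         ∎)
    where open ≤-Reasoning

  A-x⇔y : ∀ i w → A i w → InClosedNbhd G (x i) w ⇔ InClosedNbhd G (y i) w
  A-x⇔y i w w∈A with A-cases w∈A
  ... | inj₁ refl = mk⇔ (λ _ → inj₂ (E-sym (E-xy i))) (λ _ → inj₁ refl)
  ... | inj₂ (inj₁ refl) = mk⇔ (λ _ → inj₁ refl) (λ _ → inj₂ (E-xy i))
  ... | inj₂ (inj₂ (_ , Ewx , Ewy)) = mk⇔ (λ _ → inj₂ (E-sym Ewy)) (λ _ → inj₂ (E-sym Ewx))

  A-outside-complete : ∀ {i u w} → A i w → u ∉ D → E u (x i) → E w (x i) → u ≢ w → E u w
  A-outside-complete {i} {u} {w} w∈A u∉D Eux Ewx u≢w with E? u w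
  ... | yes Euw = Euw
  ... | no ¬Euw = ⊥-elim (no-pair-sandwich i (u , x i) (x i , w) Eux (E-sym Ewx)
                    (≢-sym (outside-D⇒≢x i u∉D) , [ u≢w ∘ sym , ¬Euw ])
                    (λ m≢i → inj₁ ( (outside-D⇒≢x _ u∉D , A-not-near-x (x∈A i) m≢i)
                                  ∷ (m≢i ∘ x-injective ∘ sym , A-not-near-x w∈A m≢i) ∷ [])))

  A-complete : ∀ i u w → A i u → A i w → u ≢ w → E u w
  A-complete i u w u∈A w∈A u≢w with A-cases u∈A | A-cases w∈A
  ... | inj₁ refl | _ = E-sym (A-adjacent-x w∈A (u≢w ∘ sym))
  ... | inj₂ (inj₁ refl) | _ = E-sym (A-adjacent-y w∈A (u≢w ∘ sym))
  ... | _ | inj₁ refl = A-adjacent-x u∈A u≢w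
  ... | _ | inj₂ (inj₁ refl) = A-adjacent-y u∈A u≢w
  ... | inj₂ (inj₂ (u∉D , Eux , _)) | inj₂ (inj₂ (_ , Ewx , _)) = A-outside-complete w∈A u∉D Eux Ewx u≢w

  A-no-cross-edge : ∀ i j u w → i ≢ j → A i u → A j w → ¬ E u w
  A-no-cross-edge i j u w i≢j u∈A w∈A Euw with A-cases u∈A
  ... | inj₁ refl = proj₁ (A-not-adjacent-other w∈A i≢j) (E-sym Euw)
  ... | inj₂ (inj₁ refl) = proj₂ (A-not-adjacent-other w∈A i≢j) (E-sym Euw)
  ... | inj₂ (inj₂ (u∉D , _)) = no-pair-sandwich j (u , w) (xy j) Euw (E-xy j)
          (A-fresh u∈A (i≢j ∘ sym))
          (λ m≢j → inj₁ ((outside-D⇒≢x _ u∉D , A-not-near-x w∈A m≢j) ∷ xy-precedes m≢j ∷ []))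

  A-closed-twins→ : ∀ {i u w z} → A i u → A i w → InClosedNbhd G u z → InClosedNbhd G w z
  A-closed-twins→ {i} {u} {w} {z} u∈A w∈A z∈N[u] with (z ≟ᶠ w) ⊎-dec E? w z | u ≟ᶠ w
  ... | yes z∈N[w] | _ = z∈N[w]
  ... | no z∉N[w] | yes refl = contradiction z∈N[u] z∉N[w]
  ... | no z∉N[w] | no u≢w = ⊥-elim (no-pair-sandwich i (w , proj₁ w-neighbour) (u , z)
          (proj₂ w-neighbour) Euz (u≢w , z∉N[w])
          (λ m≢i → inj₂ (A-fresh w∈A m≢i ∷ A-fresh u∈A m≢i ∷ [])))
    where
      w-neighbour : ∃ (E w)
      w-neighbour = [ (x i ,_) , (y i ,_) ]′ (proj₁ w∈A)
      Euz : E u z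
      Euz = [ (λ { refl → contradiction (inj₂ (A-complete i w u w∈A u∈A (u≢w ∘ sym))) z∉N[w] }) , id ] z∈N[u]

  A-closed-twins : ∀ i u w → A i u → A i w → ∀ z → InClosedNbhd G u z ⇔ InClosedNbhd G w z
  A-closed-twins i u w u∈A w∈A z = mk⇔ (A-closed-twins→ u∈A w∈A) (A-closed-twins→ w∈A u∈A)

  -- The graph H: parts (vi)–(viii)

  H : Fin n → Set
  H = InH G D x y

  _∼A_ : Fin n → Fin ℓ → Set
  u ∼A i = AdjAll G D x y u i

  H⇒≢x : ∀ {u} m → H u → u ≢ x m
  H⇒≢x m u∈H refl = u∈H m (x∈A m)

  H⇒≢y : ∀ {u} m → H u → u ≢ y m
  H⇒≢y m u∈H refl = u∈H m (y∈A m)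

  H-adjacent-x⇒∼A : ∀ {u m} → H u → E u (x m) → u ∼A m
  H-adjacent-x⇒∼A {u} {m} u∈H Eux w w∈A with A-closed-twins→ (x∈A m) w∈A (inj₂ (E-sym Eux))
  ... | inj₁ refl = contradiction w∈A (u∈H m)
  ... | inj₂ Ewu = E-sym Ewu

  H-fresh : ∀ {u m} → H u → ¬ E u (x m) → FreshAfter u (xy m)
  H-fresh {u} {m} u∈H ¬Eux =
      ≢-sym (H⇒≢x m u∈H)
    , [ ≢-sym (H⇒≢y m u∈H) , (λ Euy → [ H⇒≢x m u∈H , ¬Eux ∘ E-sym ]
                                          (A-closed-twins→ (y∈A m) (x∈A m) (inj₂ (E-sym Euy)))) ]

  H-edge-has-common : ∀ {u v} → H u → H v → E u v → ¬ (∀ i → ¬ (u ∼A i × v ∼A i))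
  H-edge-has-common {u} {v} u∈H v∈H Euv none = no-edge-sandwich (u , v) Euv placed
    where
      placed : ∀ m → Placeable ((u , v) ∷ []) m
      placed m with E? v (x m)
      ... | yes Evx = inj₂ (H-fresh u∈H (λ Eux → none m (H-adjacent-x⇒∼A u∈H Eux , H-adjacent-x⇒∼A v∈H Evx))
                            ∷ [])
      ... | no ¬Evx = inj₁ ((H⇒≢x m u∈H , [ H⇒≢x m v∈H , ¬Evx ∘ E-sym ]) ∷ [])

  H-non-edge-not-single : ∀ {u v i₀} → H u → H v → u ≢ v → ¬ E u v → u ∼A i₀ × v ∼A i₀ →
    ¬ (∀ i → u ∼A i × v ∼A i → i ≡ i₀)
  H-non-edge-not-single {u} {v} {i₀} u∈H v∈H u≢v ¬Euv (u∼A , v∼A) only =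
    no-pair-sandwich i₀ (v , x i₀) (x i₀ , u) (v∼A _ (x∈A i₀)) (E-sym (u∼A _ (x∈A i₀)))
      (≢-sym (H⇒≢x i₀ v∈H) , [ u≢v , ¬Euv ∘ E-sym ]) placed
    where
      placed : ∀ {m} → m ≢ i₀ → Placeable ((v , x i₀) ∷ (x i₀ , u) ∷ []) m
      placed {m} m≢i₀ with E? v (x m)
      ... | yes Evx = inj₁ ( (H⇒≢x m v∈H , A-not-near-x (x∈A i₀) m≢i₀)
                           ∷ (m≢i₀ ∘ x-injective ∘ sym , [ H⇒≢x m u∈H , m≢i₀ ∘ only m ∘ common ∘ E-sym ])
                           ∷ [])
        where
          common : E u (x m) → u ∼A m × v ∼A m
          common Eux = H-adjacent-x⇒∼A u∈H Eux , H-adjacent-x⇒∼A v∈H Evx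
      ... | no ¬Evx = inj₂ (H-fresh v∈H ¬Evx ∷ A-fresh (x∈A i₀) m≢i₀ ∷ [])

  -- Each i ∈ X has an isolated vertex b of G[B] whose only X-neighbour among the x_j is x_i;
  -- the pairs (x_i , b) then extend any Z-sequence of G[B ∖ B′].
  module _ (B : Subset n) (B⊆H : ∀ u → u ∈ B → H u) {X : Subset ℓ}
           (X-min : IsMinCover G D x y (IsolatedIn G B) X) where
    private
      Isolated : Fin n → Set
      Isolated = IsolatedIn G B

      isolated? : Decidable Isolated
      isolated? u = (u ∈? B) ×-dec all? (λ w → w ∈? B →-dec ¬? (E? u w))

      PrivateTo : Fin ℓ → Fin n → Set
      PrivateTo i b = Isolated b × E b (x i) × (∀ j → j ∈ X → E b (x j) → j ≡ i)

      privateVertex-choice : ∃ λ (b : Fin ℓ → Fin n) → ∀ {i} → i ∈ X → PrivateTo i (b i)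
      privateVertex-choice = subsetChoice X x λ i∈X →
        essential⇒private isolated? (λ b j → E? b (x j)) i∈X
          (proj₁ (proj₂ X-min)) (minimal⇒¬-minus (proj₂ (proj₂ X-min)) i∈X)

      privateVertex : Fin ℓ → Fin n
      privateVertex = proj₁ privateVertex-choice

      privateVertex-private : ∀ {i} → i ∈ X → PrivateTo i (privateVertex i)
      privateVertex-private = proj₂ privateVertex-choice

      xb : Fin ℓ → Fin n × Fin n
      xb i = x i , privateVertex i

      insideX : List (Fin ℓ)
      insideX = filter (_∈? X) (allFin ℓ)

      ∈X : ∀ {i} → i ∈ˡ insideX → i ∈ X
      ∈X = ∈-filter-allFin⁻ (_∈? X)

      xb-precedes : ∀ {i j} → i ∈ˡ insideX → j ∈ˡ insideX → i ≢ j → Precedes (xb i) (xb j)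
      xb-precedes {i} {j} i∈ j∈ i≢j =
          i≢j ∘ sym ∘ x-injective
        , [ H⇒≢x i (B⊆H _ (proj₁ b-isolated)) , (λ Exb → i≢j (b-only i (∈X i∈) (E-sym Exb))) ]
        where
          b-isolated : Isolated (privateVertex j)
          b-isolated = proj₁ (privateVertex-private (∈X j∈))
          b-only : ∀ i′ → i′ ∈ X → E (privateVertex j) (x i′) → i′ ≡ j
          b-only = proj₂ (proj₂ (privateVertex-private (∈X j∈)))

      xb-witnessed : IsWitnessed (map xb insideX)
      xb-witnessed =
          Allₚ.map⁺ (All.tabulate (λ i∈ → E-sym (proj₁ (proj₂ (privateVertex-private (∈X i∈))))))
        , AllPairsₚ.map⁺ (Unique⇒AllPairs (filter-allFin-Unique (_∈? X)) xb-precedes)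

      non-isolated-precedes-xb : ∀ {v w} → v ∈ B → ¬ Isolated v → All (Precedes (v , w)) (map xb insideX)
      non-isolated-precedes-xb {v} v∈B v-not-isolated = Allₚ.map⁺ (All.tabulate λ {i} i∈ →
        let b-isolated = proj₁ (privateVertex-private (∈X i∈))
        in ≢-sym (H⇒≢x i (B⊆H _ v∈B))
         , [ (λ b≡v → v-not-isolated (subst Isolated b≡v b-isolated))
           , (λ Evb → proj₂ b-isolated v v∈B (E-sym Evb)) ])

    cover-bound : ∀ {vs SX} → IsZSeq G (λ v → v ∈ B × ¬ Isolated v) vs →
      Represents (InXB G D x y (_∈ B)) SX → length vs + ∣ X ∣ ≤ ∣ SX ∣
    cover-bound {vs} {SX} zseq SX-rep with ZSeq⇒witnessed zseq
    ... | cs , length-cs , cs-witnessed , cs-in-B = +-cancelʳ-≤ (length outsideSX) _ _ (begin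
      length vs + ∣ X ∣ + length outsideSX   ≡⟨ +-comm (length vs + ∣ X ∣) (length outsideSX) ⟩
      length outsideSX + (length vs + ∣ X ∣) ≡⟨ cong (length outsideSX +_) (sym length-sp) ⟩
      length outsideSX + length sp           ≤⟨ sandwich-bound outsideSX (filter-allFin-Unique (∁? (_∈? SX))) sp
                                                  (witnessed-++ cs-witnessed xb-witnessed cs→xb) placed ⟩
      ℓ                                      ≡⟨ sym (∣p∣+length-filter-∉-allFin SX) ⟩
      ∣ SX ∣ + length outsideSX              ∎)
      where
        open ≤-Reasoning
        outsideSX : List (Fin ℓ)
        outsideSX = filter (∁? (_∈? SX)) (allFin ℓ)
        sp : List (Fin n × Fin n)
        sp = cs ++ map xb insideX

        length-sp : length sp ≡ length vs + ∣ X ∣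
        length-sp = trans (length-++ cs)
          (cong₂ _+_ length-cs (trans (length-map xb insideX) (length-filter-∈-allFin X)))

        cs→xb : All (λ c → All (Precedes c) (map xb insideX)) cs
        cs→xb = All.map (λ {c} (v∈B , ¬isolated) → non-isolated-precedes-xb {w = proj₂ c} v∈B ¬isolated) cs-in-B

        X⊆SX : ∀ {i} → i ∈ X → i ∈ SX
        X⊆SX i∈X = let (u , u-isolated , u∼A) = proj₁ X-min _ i∈X
                   in from (SX-rep _) (u , proj₁ u-isolated , u∼A)

        placed : ∀ {m} → m ∈ˡ outsideSX → Placeable sp m
        placed {m} m∈ = inj₂ (Allₚ.++⁺
          (All.map (λ {c} (v∈B , _) → H-fresh (B⊆H _ v∈B)
                     (λ Evx → m∉SX (from (SX-rep m) (proj₁ c , v∈B , H-adjacent-x⇒∼A (B⊆H _ v∈B) Evx))))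
                   cs-in-B)
          (Allₚ.map⁺ (All.tabulate λ {i} i∈ → A-fresh (x∈A i) (λ { refl → m∉SX (X⊆SX (∈X i∈)) }))))
          where
            m∉SX : m ∉ SX
            m∉SX = ∈-filter-allFin⁻ (∁? (_∈? SX)) m∈

proposition4p10 : ∀ {n : ℕ} (G : Graph n) → NoIsolated G
    → (D : Subset n) → IsMaxMinimalTD G D
    → (k : ℕ) → IsGammaZ G (λ _ → ⊤) k → ∣ D ∣ ≡ 2 * k
    → (ℓ : ℕ) (x y : Fin ℓ → Fin n) → IsK2Enumeration G D ℓ x y
    → ((∀ v → v ∈ D → ∃ λ i → v ≡ x i ⊎ v ≡ y i) × ∣ D ∣ ≡ 2 * ℓ)
      × (∀ i w → InA G D x y i w
           → (InClosedNbhd G (x i) w ⇔ InClosedNbhd G (y i) w))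
      × (∀ i u w → InA G D x y i u → InA G D x y i w → u ≢ w → Graph.E G u w)
      × (∀ i j u w → i ≢ j → InA G D x y i u → InA G D x y j w → ¬ Graph.E G u w)
      × (∀ i u w → InA G D x y i u → InA G D x y i w
           → ∀ z → (InClosedNbhd G u z ⇔ InClosedNbhd G w z))
      × (∀ u v → InH G D x y u → InH G D x y v → Graph.E G u v
           → ∀ S → Represents (λ i → AdjAll G D x y u i × AdjAll G D x y v i) S
           → 1 ≤ ∣ S ∣)
      × (∀ u v → InH G D x y u → InH G D x y v → u ≢ v → ¬ Graph.E G u v
           → ∀ S → Represents (λ i → AdjAll G D x y u i × AdjAll G D x y v i) S
           → ∣ S ∣ ≢ 1)
      × (∀ (B : Subset n) → (∀ u → u ∈ B → InH G D x y u)
           → ∀ k' m SX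
           → IsGammaZ G (λ v → v ∈ B × ¬ IsolatedIn G B v) k'
           → IsMB G D x y (IsolatedIn G B) m
           → Represents (InXB G D x y (λ u → u ∈ B)) SX
           → k' + m ≤ ∣ SX ∣)
-- a total dominating set already forces NoIsolated
proposition4p10 G _ D D-max k γᶻ≡k ∣D∣≡2k ℓ x y components =
    (D⊆endpoints , ∣D∣≡2ℓ)
  , A-x⇔y
  , A-complete
  , A-no-cross-edge
  , A-closed-twins
  , (λ u v u∈H v∈H Euv S S-rep → represents-1≤ S-rep (H-edge-has-common u∈H v∈H Euv))
  , (λ u v u∈H v∈H u≢v ¬Euv S S-rep ∣S∣≡1 →
       let (i₀ , common , only) = represents-single S-rep ∣S∣≡1
       in H-non-edge-not-single u∈H v∈H u≢v ¬Euv common only)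
  , (λ { B B⊆H _ _ SX ((vs , zseq , refl) , _) ((X , X-min , refl) , _) SX-rep →
         cover-bound B B⊆H X-min zseq SX-rep })
  where open Extremal G D D-max k γᶻ≡k ∣D∣≡2k ℓ x y components
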